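{- Let $R$ be an associative ring, $r\in R$, $A$ a commutative subring of $R$ such that the map $\mathrm{ad}_r:a\mapsto ra-ar$ carries $A$ into itself, and $p$ a prime number. Then the function sending each $a\in A$ to $$(ar)^{p-1}a-a^pr^{p-1}-\mathrm{ad}_{ar}^{\,p-1}(a)$$ can be written as a noncommutative polynomial in $r$ and the elements $a,\mathrm{ad}_r(a),\mathrm{ad}_r^2(a),\dots$, with integer coefficients, in which the coefficient of every monomial is divisible by $p$.
   Context: $\mathrm{ad}_{ar}(x)=(ar)x-x(ar)$, and $\mathrm{ad}^{k}$ denotes the $k$-fold iterate. The polynomial is meant to be a fixed (universal) integer-coefficient expression in these symbols, independent of $a$, which evaluates to the given element for every $a\in A$. -}

module Defs where

open import Level using (Level; _⊔_)
open import Data.Nat using (ℕ; zero; suc; _∸_)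
open import Data.Integer using (ℤ; +_; -[1+_])
open import Data.Integer.Divisibility as ℤ∣ using ()
open import Data.List using (List; []; _∷_)
open import Data.Product using (_×_; _,_)
open import Relation.Unary using (Pred; _∈_)
open import Algebra.Bundles using (Ring)

-- Variables of the noncommutative polynomial ring ℤ⟨r, x₀, x₁, x₂, …⟩;
-- `vx i` stands for ad_r^i(a).
data Var : Set where
  vr : Var
  vx : ℕ → Var

-- A monomial is a word in the variables; a noncommutative polynomial
-- with integer coefficients is a finite list of (coefficient, monomial).
Monomial : Set
Monomial = List Var

NCPoly : Set
NCPoly = List (ℤ × Monomial)

data AllCoeffsDivBy (p : ℤ) : NCPoly → Set where
  []  : AllCoeffsDivBy p []
  _∷_ : ∀ {c m P} → p ℤ∣.∣ c → AllCoeffsDivBy p P → AllCoeffsDivBy p ((c , m) ∷ P)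

module RingOps {c ℓ : Level} (R : Ring c ℓ) where
  open Ring R

  iter : (Carrier → Carrier) → ℕ → Carrier → Carrier
  iter f zero    x = x
  iter f (suc k) x = f (iter f k x)

  pow : Carrier → ℕ → Carrier
  pow x zero    = 1#
  pow x (suc k) = x * pow x k

  ad : Carrier → Carrier → Carrier
  ad y x = y * x - x * y

  natR : ℕ → Carrier
  natR zero    = 0#
  natR (suc n) = 1# + natR n

  intR : ℤ → Carrier
  intR (+ n)     = natR n
  intR -[1+ n ]  = - natR (suc n)

  evalVar : Carrier → Carrier → Var → Carrier
  evalVar r a vr     = r
  evalVar r a (vx i) = iter (ad r) i a

  evalMono : Carrier → Carrier → Monomial → Carrier
  evalMono r a []       = 1#
  evalMono r a (v ∷ vs) = evalVar r a v * evalMono r a vs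

  evalPoly : Carrier → Carrier → NCPoly → Carrier
  evalPoly r a []            = 0#
  evalPoly r a ((k , m) ∷ P) = intR k * evalMono r a m + evalPoly r a P

  record IsCommSubring {ℓA : Level} (A : Pred Carrier ℓA) : Set (c ⊔ ℓ ⊔ ℓA) where
    field
      resp   : ∀ {x y} → x ≈ y → x ∈ A → y ∈ A
      zero∈  : 0# ∈ A
      one∈   : 1# ∈ A
      +-cl   : ∀ {x y} → x ∈ A → y ∈ A → (x + y) ∈ A
      neg-cl : ∀ {x} → x ∈ A → (- x) ∈ A
      *-cl   : ∀ {x y} → x ∈ A → y ∈ A → (x * y) ∈ A
      comm   : ∀ {x y} → x ∈ A → y ∈ A → (x * y) ≈ (y * x)

  lhsExpr : ℕ → Carrier → Carrier → Carrier
  lhsExpr p r a =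
    pow (a * r) (p ∸ 1) * a - pow a p * pow r (p ∸ 1) - iter (ad (a * r)) (p ∸ 1) a

module Submission where

-- Lemma 8.1.  Fix a ∈ A and put δ(x) = a·ad_r(x): δ maps A into A, is a
-- derivation there, and agrees with ad_{ar} on A.  Moving each factor ar to
-- the right gives (ar)ⁿc = Σ_j coeff c n j · rʲ, where coeff c (n+1) j =
-- a·coeff c n (j-1) + δ(coeff c n j).  The extreme coefficients of
-- (ar)^{p-1}a are δ^{p-1}(a) = ad_{ar}^{p-1}(a) and aᵖ, so the expression of
-- the theorem is the sum of the middle terms, whose coefficients are those of
-- (ar)ᵖ·1 in degrees 2, …, p-1.  The key identity
--     (j+1)·coeff 1 n (j+1) = Σ_k C(n,k)·δ^{k-1}(a)·coeff 1 (n-k) j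
-- makes them divisible by p when n = p, since p ∣ C(p,k) for 0 < k < p and
-- j+1 is invertible mod p.  Divisibility is tracked as "p times a signed sum
-- of monomials in r and the ad_r^i(a)", which reads off as an integer
-- polynomial with coefficients ±p.  Running the argument in the ring of
-- functions A → R at the generic point a = id gives one polynomial that
-- works for every a ∈ A simultaneously.

open import Defs
open import Level using (Level; _⊔_)
open import Data.Nat using (ℕ; zero; suc; _∸_; _<_; s≤s; z≤n) renaming (_*_ to _*ℕ_)
open import Data.Integer using (+_; -[1+_])
open import Data.List using (List; []; _∷_; _++_)
open import Data.Bool using (Bool; true; false; not; _xor_)
open import Data.Product using (Σ; _,_)
open import Algebra.Bundles using (Ring)
open import Relation.Unary using (Pred; _∈_)
open import Data.Nat.Primality using (Prime)
open import Relation.Binary.PropositionalEquality using (_≡_)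
import Relation.Binary.PropositionalEquality as ≡

module Binomial where
  open import Data.Nat
  open import Data.Nat.Properties
  open import Data.Nat.Divisibility using (_∣_; m∣m*n; ∣⇒≤)
  open import Data.Nat.Primality using (euclidsLemma)
  open import Data.Nat.Tactic.RingSolver using (solve)
  open import Data.Sum using (inj₁; inj₂)
  open import Relation.Nullary using (contradiction)
  open import Relation.Binary.PropositionalEquality
  open ≡-Reasoning

  binomial : ℕ → ℕ → ℕ
  binomial n       zero    = 1
  binomial zero    (suc k) = 0
  binomial (suc n) (suc k) = binomial n k + binomial n (suc k)

  binomial-vanish : ∀ {n k} → n < k → binomial n k ≡ 0
  binomial-vanish {zero}  {suc k} _ = refl
  binomial-vanish {suc n} {suc k} (s≤s n<k) =
    cong₂ _+_ (binomial-vanish n<k) (binomial-vanish (m≤n⇒m≤1+n n<k))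

  binomial-one : ∀ n → binomial n 1 ≡ n
  binomial-one zero    = refl
  binomial-one (suc n) = cong suc (binomial-one n)

  binomial-absorb : ∀ n k → suc k * binomial (suc n) (suc k) ≡ suc n * binomial n k
  binomial-absorb zero    zero    = refl
  binomial-absorb zero    (suc k) = *-zeroʳ (2 + k)
  binomial-absorb (suc n) zero    = begin
    1 * (1 + binomial (suc n) 1) ≡⟨ cong (λ b → 1 * (1 + b)) (binomial-one (suc n)) ⟩
    1 * (2 + n)                  ≡⟨ *-comm 1 (2 + n) ⟩
    (2 + n) * 1                  ∎
  binomial-absorb (suc n) (suc k) =
    step k n (binomial n k) (binomial n (suc k)) (binomial (suc n) (suc (suc k)))
      (binomial-absorb n k) (binomial-absorb n (suc k))
    where
    step : ∀ k n c d e → suc k * (c + d) ≡ suc n * c → (2 + k) * e ≡ suc n * d →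
           (2 + k) * (c + d + e) ≡ (2 + n) * (c + d)
    step k n c d e ih₁ ih₂ = begin
      (2 + k) * (c + d + e)                     ≡⟨ solve (k ∷ c ∷ d ∷ e ∷ []) ⟩
      (suc k * (c + d) + (c + d)) + (2 + k) * e ≡⟨ cong₂ (λ x y → x + (c + d) + y) ih₁ ih₂ ⟩
      (suc n * c + (c + d)) + suc n * d         ≡⟨ solve (n ∷ c ∷ d ∷ []) ⟩
      (2 + n) * (c + d)                         ∎
      where open import Data.List using (_∷_; [])

  prime∣binomial : ∀ {q k} → Prime (suc q) → k < q → suc q ∣ binomial (suc q) (suc k)
  prime∣binomial {q} {k} p-prime k<q
    with euclidsLemma (suc k) (binomial (suc q) (suc k)) p-prime
           (subst (suc q ∣_) (sym (binomial-absorb q k)) (m∣m*n (binomial q k)))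
  ... | inj₂ p∣C = p∣C
  ... | inj₁ p∣k = contradiction (∣⇒≤ p∣k) (<⇒≱ (s≤s k<q))

module RingFacts {c ℓ} (R : Ring c ℓ) where
  open Ring R
  open RingOps R
  open import Algebra.Properties.Ring R
  open import Algebra.Properties.Semiring.Mult semiring public
  open import Algebra.Properties.CommutativeSemigroup +-commutativeSemigroup using (interchange)
  open import Algebra.Properties.CommutativeMonoid.Mult +-commutativeMonoid public using (×-distrib-+)
  import Data.Nat.Properties as ℕ
  open import Relation.Binary.Reasoning.Setoid setoid

  ×-comm : ∀ m n x → m × (n × x) ≈ n × (m × x)
  ×-comm m n x = begin
    m × (n × x)    ≈⟨ ×-assocˡ x m n ⟩
    (m *ℕ n) × x   ≈⟨ ×-congˡ (ℕ.*-comm m n) ⟩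
    (n *ℕ m) × x   ≈⟨ ×-assocˡ x n m ⟨
    n × (m × x)    ∎

  ×-0# : ∀ n → n × 0# ≈ 0#
  ×-0# zero    = refl
  ×-0# (suc n) = trans (+-identityˡ (n × 0#)) (×-0# n)

  ×-neg : ∀ n x → n × (- x) ≈ - (n × x)
  ×-neg zero    x = sym -0#≈0#
  ×-neg (suc n) x = trans (+-congˡ (×-neg n x)) (-‿+-comm x (n × x))

  natR-* : ∀ n x → natR n * x ≈ n × x
  natR-* zero    x = zeroˡ x
  natR-* (suc n) x = trans (distribʳ x 1# (natR n)) (+-cong (*-identityˡ x) (natR-* n x))

  strip-ends : ∀ x m y → ((x + m) + y) - y - x ≈ m
  strip-ends x m y = trans (+-congʳ (//-rightDividesʳ y (x + m))) (xyx⁻¹≈y x m)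

  ad-cong : ∀ y {x x′} → x ≈ x′ → ad y x ≈ ad y x′
  ad-cong y x≈x′ = +-cong (*-congˡ x≈x′) (-‿cong (*-congʳ x≈x′))

  ad-+ : ∀ y x x′ → ad y (x + x′) ≈ ad y x + ad y x′
  ad-+ y x x′ = begin
    y * (x + x′) - (x + x′) * y            ≈⟨ +-cong (distribˡ y x x′) (-‿cong (distribʳ y x x′)) ⟩
    (y * x + y * x′) - (x * y + x′ * y)    ≈⟨ +-congˡ (-‿+-comm (x * y) (x′ * y)) ⟨
    (y * x + y * x′) + (- (x * y) + - (x′ * y)) ≈⟨ interchange (y * x) (y * x′) _ _ ⟩
    ad y x + ad y x′                       ∎

  ad-0 : ∀ y → ad y 0# ≈ 0#
  ad-0 y = trans (+-cong (zeroʳ y) (-‿cong (zeroˡ y))) (-‿inverseʳ 0#)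

  ad-1 : ∀ y → ad y 1# ≈ 0#
  ad-1 y = trans (+-cong (*-identityʳ y) (-‿cong (*-identityˡ y))) (-‿inverseʳ y)

  ad-leibniz : ∀ y x x′ → ad y (x * x′) ≈ ad y x * x′ + x * ad y x′
  ad-leibniz y x x′ = sym (begin
    (y * x - x * y) * x′ + x * (y * x′ - x′ * y)
      ≈⟨ +-cong ([y-z]x≈yx-zx x′ (y * x) (x * y)) (x[y-z]≈xy-xz x (y * x′) (x′ * y)) ⟩
    (y * x * x′ - x * y * x′) + (x * (y * x′) - x * (x′ * y))
      ≈⟨ +-cong (+-cong (*-assoc y x x′) (-‿cong (*-assoc x y x′))) (+-congˡ (-‿cong (sym (*-assoc x x′ y)))) ⟩
    (y * (x * x′) - x * (y * x′)) + (x * (y * x′) - x * x′ * y)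
      ≈⟨ +-assoc (y * (x * x′)) _ _ ⟩
    y * (x * x′) + (- (x * (y * x′)) + (x * (y * x′) - x * x′ * y))
      ≈⟨ +-congˡ (+-assoc _ _ _) ⟨
    y * (x * x′) + ((- (x * (y * x′)) + x * (y * x′)) - x * x′ * y)
      ≈⟨ +-congˡ (trans (+-congʳ (-‿inverseˡ _)) (+-identityˡ _)) ⟩
    ad y (x * x′) ∎)

  commute-past : ∀ y x → y * x ≈ x * y + ad y x
  commute-past y x = sym (begin
    x * y + (y * x - x * y)    ≈⟨ +-comm (x * y) _ ⟩
    (y * x - x * y) + x * y    ≈⟨ //-rightDividesˡ (x * y) (y * x) ⟩
    y * x                      ∎)

  shuffle : ∀ u v x y → (u + v) + (x + y) ≈ (v + y) + (x + u)
  shuffle u v x y = begin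
    (u + v) + (x + y) ≈⟨ +-congʳ (+-comm u v) ⟩
    (v + u) + (x + y) ≈⟨ interchange v u x y ⟩
    (v + x) + (u + y) ≈⟨ +-congˡ (+-comm u y) ⟩
    (v + x) + (y + u) ≈⟨ interchange v x y u ⟩
    (v + y) + (x + u) ∎

  pow-comm : ∀ x n → pow x n * x ≈ x * pow x n
  pow-comm x zero    = trans (*-identityˡ x) (sym (*-identityʳ x))
  pow-comm x (suc n) = trans (*-assoc x (pow x n) x) (*-congˡ (pow-comm x n))

module FiniteSums {c ℓ} (R : Ring c ℓ) where
  open Ring R
  open RingFacts R
  open import Algebra.Properties.CommutativeSemigroup +-commutativeSemigroup using (interchange)
  open Binomial using (binomial; binomial-vanish)
  open import Data.Nat.Properties using (n<1+n; +-∸-assoc; ≤-pred)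
  open import Relation.Binary.Reasoning.Setoid setoid

  ∑< : ℕ → (ℕ → Carrier) → Carrier
  ∑< zero    f = 0#
  ∑< (suc n) f = f 0 + ∑< n (λ k → f (suc k))

  ∑-cong : ∀ n {f g} → (∀ k → k < n → f k ≈ g k) → ∑< n f ≈ ∑< n g
  ∑-cong zero    f≈g = refl
  ∑-cong (suc n) f≈g = +-cong (f≈g 0 (s≤s z≤n)) (∑-cong n (λ k k<n → f≈g (suc k) (s≤s k<n)))

  ∑-+ : ∀ n f g → ∑< n (λ k → f k + g k) ≈ ∑< n f + ∑< n g
  ∑-+ zero    f g = sym (+-identityˡ 0#)
  ∑-+ (suc n) f g = trans (+-congˡ (∑-+ n _ _)) (interchange _ _ _ _)

  ∑-*ˡ : ∀ n x f → x * ∑< n f ≈ ∑< n (λ k → x * f k)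
  ∑-*ˡ zero    x f = zeroʳ x
  ∑-*ˡ (suc n) x f = trans (distribˡ x _ _) (+-congˡ (∑-*ˡ n x _))

  ∑-snoc : ∀ n f → ∑< (suc n) f ≈ ∑< n f + f n
  ∑-snoc zero    f = trans (+-identityʳ (f 0)) (sym (+-identityˡ (f 0)))
  ∑-snoc (suc n) f = trans (+-congˡ (∑-snoc n _)) (sym (+-assoc _ _ _))

  ∑-drop-last : ∀ n f → f n ≈ 0# → ∑< (suc n) f ≈ ∑< n f
  ∑-drop-last n f fn≈0 = trans (∑-snoc n f) (trans (+-congˡ fn≈0) (+-identityʳ _))

  ∑-peel : ∀ n f → ∑< (suc (suc n)) f ≈ (f 0 + ∑< n (λ k → f (suc k))) + f (suc n)
  ∑-peel n f = trans (+-congˡ (∑-snoc n _)) (sym (+-assoc _ _ _))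

  -- lattice n g adds up g(k, m) over the endpoints (k, m) of all 2ⁿ lattice
  -- paths of n unit steps from (0, 0), each step increasing k or m
  lattice : ℕ → (ℕ → ℕ → Carrier) → Carrier
  lattice zero    g = g 0 0
  lattice (suc n) g = lattice n (λ k m → g k (suc m)) + lattice n (λ k m → g (suc k) m)

  lattice-cong : ∀ n {g h} → (∀ k m → g k m ≈ h k m) → lattice n g ≈ lattice n h
  lattice-cong zero    g≈h = g≈h 0 0
  lattice-cong (suc n) g≈h =
    +-cong (lattice-cong n (λ k m → g≈h k (suc m))) (lattice-cong n (λ k m → g≈h (suc k) m))

  lattice-+ : ∀ n g h → lattice n (λ k m → g k m + h k m) ≈ lattice n g + lattice n h
  lattice-+ zero    g h = refl
  lattice-+ (suc n) g h = trans (+-cong (lattice-+ n _ _) (lattice-+ n _ _)) (interchange _ _ _ _)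

  lattice-0 : ∀ n {g} → (∀ k m → g k m ≈ 0#) → lattice n g ≈ 0#
  lattice-0 zero    g≈0 = g≈0 0 0
  lattice-0 (suc n) g≈0 =
    trans (+-cong (lattice-0 n (λ k m → g≈0 k (suc m))) (lattice-0 n (λ k m → g≈0 (suc k) m)))
          (+-identityʳ 0#)

  lattice-additive : ∀ (f : Carrier → Carrier) → (∀ {x y} → x ≈ y → f x ≈ f y) →
                     (∀ x y → f (x + y) ≈ f x + f y) →
                     ∀ n g → lattice n (λ k m → f (g k m)) ≈ f (lattice n g)
  lattice-additive f f-cong f-+ zero    g = refl
  lattice-additive f f-cong f-+ (suc n) g =
    trans (+-cong (lattice-additive f f-cong f-+ n _) (lattice-additive f f-cong f-+ n _)) (sym (f-+ _ _))

  atColumn0 : ℕ → Carrier → Carrier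
  atColumn0 zero    y = y
  atColumn0 (suc k) y = 0#

  -- only the path that never increases k ends in column 0
  lattice-column0 : ∀ n h → lattice n (λ k m → atColumn0 k (h m)) ≈ h n
  lattice-column0 zero    h = refl
  lattice-column0 (suc n) h =
    trans (+-cong (lattice-column0 n (λ m → h (suc m))) (lattice-0 n (λ k m → refl))) (+-identityʳ _)

  lattice-closed : ∀ n g → lattice n g ≈ ∑< (suc n) (λ k → binomial n k × g k (n ∸ k))
  lattice-closed zero    g = sym (trans (+-identityʳ (1 × g 0 0)) (×-homo-1 (g 0 0)))
  lattice-closed (suc n) g = begin
    lattice n (λ k m → g k (suc m)) + lattice n (λ k m → g (suc k) m)
      ≈⟨ +-cong (lattice-closed n _) (lattice-closed n _) ⟩
    ∑< (suc n) (λ k → binomial n k × g k (suc (n ∸ k))) + ∑< (suc n) B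
      ≈⟨ +-congʳ (∑-cong (suc n) (λ k k≤n → ×-congʳ (binomial n k)
           (reflexive (≡.cong (g k) (≡.sym (+-∸-assoc 1 (≤-pred k≤n))))))) ⟩
    ∑< (suc n) h + ∑< (suc n) B
      ≈⟨ +-congʳ (∑-drop-last (suc n) h (×-congˡ (binomial-vanish (n<1+n n)))) ⟨
    (h 0 + ∑< (suc n) A) + ∑< (suc n) B
      ≈⟨ trans (+-assoc _ _ _) (+-congˡ (+-comm _ _)) ⟩
    h 0 + (∑< (suc n) B + ∑< (suc n) A)
      ≈⟨ +-congˡ (∑-+ (suc n) B A) ⟨
    h 0 + ∑< (suc n) (λ k → B k + A k)
      ≈⟨ +-congˡ (∑-cong (suc n) (λ k _ → ×-homo-+ (g (suc k) (n ∸ k)) (binomial n k) (binomial n (suc k)))) ⟨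
    ∑< (suc (suc n)) (λ k → binomial (suc n) k × g k (suc n ∸ k)) ∎
    where
    h A B : ℕ → Carrier
    h k = binomial n k × g k (suc n ∸ k)
    A k = binomial n (suc k) × g (suc k) (n ∸ k)
    B k = binomial n k × g (suc k) (n ∸ k)

-- An element is
-- *expressible* if it equals such a sum; these are exactly the values at
-- (r, a) of integer noncommutative polynomials, kept with ±1 coefficients so
-- that products can be formed without arithmetic on the coefficients.
module SignedSums {c ℓ} (R : Ring c ℓ) (r a : Ring.Carrier R) where
  open Ring R
  open RingOps R
  open RingFacts R
  open FiniteSums R using (∑<)
  open import Algebra.Properties.Ring R
  open import Relation.Binary.Reasoning.Setoid setoid

  record SignedMonomial : Set where
    constructor _·_
    field
      negative : Bool
      word     : Monomial

  SignedPoly : Set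
  SignedPoly = List SignedMonomial

  sign : Bool → Carrier → Carrier
  sign false x = x
  sign true  x = - x

  ⟦_⟧ : SignedPoly → Carrier
  ⟦ [] ⟧          = 0#
  ⟦ s · m ∷ P ⟧ = sign s (evalMono r a m) + ⟦ P ⟧

  sign-cong : ∀ s {x y} → x ≈ y → sign s x ≈ sign s y
  sign-cong false x≈y = x≈y
  sign-cong true  x≈y = -‿cong x≈y

  sign-not : ∀ s x → sign (not s) x ≈ - sign s x
  sign-not false x = refl
  sign-not true  x = sym (-‿involutive x)

  sign-* : ∀ s t x y → sign s x * sign t y ≈ sign (s xor t) (x * y)
  sign-* false false x y = refl
  sign-* false true  x y = sym (-‿distribʳ-* x y)
  sign-* true  false x y = sym (-‿distribˡ-* x y)
  sign-* true  true  x y = trans (sym (-‿distribˡ-* x (- y)))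
                             (trans (-‿cong (sym (-‿distribʳ-* x y))) (-‿involutive (x * y)))

  evalMono-++ : ∀ m m′ → evalMono r a (m ++ m′) ≈ evalMono r a m * evalMono r a m′
  evalMono-++ []      m′ = sym (*-identityˡ _)
  evalMono-++ (v ∷ m) m′ = trans (*-congˡ (evalMono-++ m m′)) (sym (*-assoc _ _ _))

  ⟦++⟧ : ∀ P Q → ⟦ P ++ Q ⟧ ≈ ⟦ P ⟧ + ⟦ Q ⟧
  ⟦++⟧ []          Q = sym (+-identityˡ ⟦ Q ⟧)
  ⟦++⟧ (s · m ∷ P) Q = trans (+-congˡ (⟦++⟧ P Q)) (sym (+-assoc _ _ _))

  negate : SignedPoly → SignedPoly
  negate []          = []
  negate (s · m ∷ P) = not s · m ∷ negate P

  ⟦negate⟧ : ∀ P → ⟦ negate P ⟧ ≈ - ⟦ P ⟧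
  ⟦negate⟧ []          = sym -0#≈0#
  ⟦negate⟧ (s · m ∷ P) = trans (+-cong (sign-not s _) (⟦negate⟧ P)) (-‿+-comm _ _)

  scale : SignedMonomial → SignedPoly → SignedPoly
  scale t           []          = []
  scale (s · m) (t · m′ ∷ Q) = (s xor t) · (m ++ m′) ∷ scale (s · m) Q

  ⟦scale⟧ : ∀ s m Q → ⟦ scale (s · m) Q ⟧ ≈ sign s (evalMono r a m) * ⟦ Q ⟧
  ⟦scale⟧ s m []           = sym (zeroʳ _)
  ⟦scale⟧ s m (t · m′ ∷ Q) = trans
    (+-cong (trans (sign-cong (s xor t) (evalMono-++ m m′)) (sym (sign-* s t _ _))) (⟦scale⟧ s m Q))
    (sym (distribˡ _ _ _))

  multiply : SignedPoly → SignedPoly → SignedPoly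
  multiply []      Q = []
  multiply (t ∷ P) Q = scale t Q ++ multiply P Q

  ⟦multiply⟧ : ∀ P Q → ⟦ multiply P Q ⟧ ≈ ⟦ P ⟧ * ⟦ Q ⟧
  ⟦multiply⟧ []          Q = sym (zeroˡ ⟦ Q ⟧)
  ⟦multiply⟧ (s · m ∷ P) Q = trans (⟦++⟧ (scale (s · m) Q) (multiply P Q))
    (trans (+-cong (⟦scale⟧ s m Q) (⟦multiply⟧ P Q)) (sym (distribʳ _ _ _)))

  Expressible : Carrier → Set ℓ
  Expressible x = Σ SignedPoly (λ P → x ≈ ⟦ P ⟧)

  expr-0 : Expressible 0#
  expr-0 = [] , refl

  expr-1 : Expressible 1#
  expr-1 = false · [] ∷ [] , sym (+-identityʳ 1#)

  expr-r : Expressible r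
  expr-r = false · (vr ∷ []) ∷ [] , sym (trans (+-identityʳ _) (*-identityʳ r))

  expr-a : Expressible a
  expr-a = false · (vx 0 ∷ []) ∷ [] , sym (trans (+-identityʳ _) (*-identityʳ a))

  expr-+ : ∀ {x y} → Expressible x → Expressible y → Expressible (x + y)
  expr-+ (P , x≈P) (Q , y≈Q) = P ++ Q , trans (+-cong x≈P y≈Q) (sym (⟦++⟧ P Q))

  expr-neg : ∀ {x} → Expressible x → Expressible (- x)
  expr-neg (P , x≈P) = negate P , trans (-‿cong x≈P) (sym (⟦negate⟧ P))

  expr-* : ∀ {x y} → Expressible x → Expressible y → Expressible (x * y)
  expr-* (P , x≈P) (Q , y≈Q) = multiply P Q , trans (*-cong x≈P y≈Q) (sym (⟦multiply⟧ P Q))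

  expr-× : ∀ n {x} → Expressible x → Expressible (n × x)
  expr-× zero    _  = expr-0
  expr-× (suc n) ex = expr-+ ex (expr-× n ex)

  expr-pow : ∀ {x} → Expressible x → ∀ n → Expressible (pow x n)
  expr-pow ex zero    = expr-1
  expr-pow ex (suc n) = expr-* ex (expr-pow ex n)

  expr-ad : ∀ {x} → Expressible x → Expressible (ad r x)
  expr-ad ex = expr-+ (expr-* expr-r ex) (expr-neg (expr-* ex expr-r))

  module Divisibility (p : ℕ) where
    open import Data.Nat.Coprimality using (Coprime; coprime⇒GCD≡1)
    open import Data.Nat.GCD using (module Bézout)
    open Bézout.Identity using (+-; -+)
    open import Data.Nat.Divisibility using (∣-refl; ∣-reflexive)
    open import Data.Integer.Base using (ℤ) renaming (-_ to ℤ-)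
    open import Data.Integer.Properties using (∣-i∣≡∣i∣)

    Divisible : Carrier → Set ℓ
    Divisible x = Σ SignedPoly (λ P → x ≈ p × ⟦ P ⟧)

    div-resp : ∀ {x y} → x ≈ y → Divisible x → Divisible y
    div-resp x≈y (P , x≈pP) = P , trans (sym x≈y) x≈pP

    div-0 : Divisible 0#
    div-0 = [] , sym (×-0# p)

    div-≈0 : ∀ {x} → x ≈ 0# → Divisible x
    div-≈0 x≈0 = div-resp (sym x≈0) div-0

    div-+ : ∀ {x y} → Divisible x → Divisible y → Divisible (x + y)
    div-+ (P , x≈pP) (Q , y≈pQ) = P ++ Q ,
      trans (+-cong x≈pP y≈pQ) (trans (sym (×-distrib-+ _ _ p)) (×-congʳ p (sym (⟦++⟧ P Q))))

    div-∑ : ∀ n {f} → (∀ k → k < n → Divisible (f k)) → Divisible (∑< n f)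
    div-∑ zero    _   = div-0
    div-∑ (suc n) dfk = div-+ (dfk 0 (s≤s z≤n)) (div-∑ n (λ k k<n → dfk (suc k) (s≤s k<n)))

    div-neg : ∀ {x} → Divisible x → Divisible (- x)
    div-neg (P , x≈pP) = negate P ,
      trans (-‿cong x≈pP) (trans (sym (×-neg p _)) (×-congʳ p (sym (⟦negate⟧ P))))

    div-*ʳ : ∀ {x y} → Divisible x → Expressible y → Divisible (x * y)
    div-*ʳ (P , x≈pP) (Q , y≈Q) = multiply P Q ,
      trans (*-cong x≈pP y≈Q) (trans (×-assoc-* p _ _) (×-congʳ p (sym (⟦multiply⟧ P Q))))

    div-× : ∀ n {x} → Divisible x → Divisible (n × x)
    div-× n (P , x≈pP) with expr-× n (P , refl)
    ... | (Q , nP≈Q) = Q , trans (×-congʳ n x≈pP) (trans (×-comm n p _) (×-congʳ p nP≈Q))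

    div-multiple : ∀ k {x} → Expressible x → Divisible ((k *ℕ p) × x)
    div-multiple k {x} ex with expr-× k ex
    ... | (Q , kx≈Q) = Q , trans (sym (×-assocˡ x k p)) (trans (×-comm k p x) (×-congʳ p kx≈Q))

    div-consecutive : ∀ m n {x} → suc m ≡ n → Divisible (m × x) → Divisible (n × x) → Divisible x
    div-consecutive m n {x} ≡.refl dm dn = div-resp (//-rightDividesʳ (m × x) x) (div-+ dn (div-neg dm))

    div-cancel : ∀ {j x} → Coprime j p → Expressible x → Divisible (j × x) → Divisible x
    div-cancel {j} {x} j⊥p ex dj with Bézout.identity (coprime⇒GCD≡1 j⊥p)
    ... | +- u v 1+vp≡uj = div-consecutive (v *ℕ p) (u *ℕ j) 1+vp≡uj (div-multiple v ex)
                            (div-resp (×-assocˡ x u j) (div-× u dj))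
    ... | -+ u v 1+uj≡vp = div-consecutive (u *ℕ j) (v *ℕ p) 1+uj≡vp
                            (div-resp (×-assocˡ x u j) (div-× u dj)) (div-multiple v ex)

    coefficient : Bool → ℤ
    coefficient false = + p
    coefficient true  = ℤ- (+ p)

    toNCPoly : SignedPoly → NCPoly
    toNCPoly []          = []
    toNCPoly (s · m ∷ P) = (coefficient s , m) ∷ toNCPoly P

    toNCPoly-coeffs : ∀ P → AllCoeffsDivBy (+ p) (toNCPoly P)
    toNCPoly-coeffs []              = []
    toNCPoly-coeffs (false · m ∷ P) = ∣-refl ∷ toNCPoly-coeffs P
    toNCPoly-coeffs (true  · m ∷ P) = ∣-reflexive (≡.sym (∣-i∣≡∣i∣ (+ p))) ∷ toNCPoly-coeffs P

    intR-coefficient : ∀ s x → intR (coefficient s) * x ≈ p × sign s x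
    intR-coefficient false x = natR-* p x
    intR-coefficient true  x = begin
      intR (ℤ- (+ p)) * x ≈⟨ *-congʳ (intR-neg p) ⟩
      - natR p * x         ≈⟨ -‿distribˡ-* (natR p) x ⟨
      - (natR p * x)       ≈⟨ -‿cong (natR-* p x) ⟩
      - (p × x)            ≈⟨ ×-neg p x ⟨
      p × (- x)            ∎
      where
      intR-neg : ∀ n → intR (ℤ- (+ n)) ≈ - natR n
      intR-neg zero    = sym -0#≈0#
      intR-neg (suc n) = refl

    toNCPoly-eval : ∀ P → evalPoly r a (toNCPoly P) ≈ p × ⟦ P ⟧
    toNCPoly-eval []          = sym (×-0# p)
    toNCPoly-eval (s · m ∷ P) =
      trans (+-cong (intR-coefficient s _) (toNCPoly-eval P)) (sym (×-distrib-+ _ _ p))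

module Expansion {c ℓ ℓA} (R : Ring c ℓ) (r : Ring.Carrier R) (A : Pred (Ring.Carrier R) ℓA)
    (A-subring : RingOps.IsCommSubring R A)
    (ad-closed : ∀ {x} → x ∈ A → RingOps.ad R r x ∈ A)
    (a : Ring.Carrier R) (a∈A : a ∈ A) where
  open Ring R hiding (zero)
  open RingOps R
  open RingOps.IsCommSubring A-subring
  open RingFacts R
  open FiniteSums R
  open SignedSums R r a
  open import Data.Nat.Properties using (≤-refl; m≤n⇒m≤1+n)
  open import Relation.Binary.Reasoning.Setoid setoid

  δ : Carrier → Carrier
  δ x = a * ad r x

  δ∈A : ∀ {x} → x ∈ A → δ x ∈ A
  δ∈A x∈A = *-cl a∈A (ad-closed x∈A)

  expr-δ : ∀ {x} → Expressible x → Expressible (δ x)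
  expr-δ ex = expr-* expr-a (expr-ad ex)

  δ-cong : ∀ {x y} → x ≈ y → δ x ≈ δ y
  δ-cong x≈y = *-congˡ (ad-cong r x≈y)

  δ-+ : ∀ x y → δ (x + y) ≈ δ x + δ y
  δ-+ x y = trans (*-congˡ (ad-+ r x y)) (distribˡ a _ _)

  δ-0 : δ 0# ≈ 0#
  δ-0 = trans (*-congˡ (ad-0 r)) (zeroʳ a)

  δ-1 : δ 1# ≈ 0#
  δ-1 = trans (*-congˡ (ad-1 r)) (zeroʳ a)

  -- Leibniz rule; the factor a may be moved past x because A is commutative
  δ-leibniz : ∀ {x} y → x ∈ A → δ (x * y) ≈ δ x * y + x * δ y
  δ-leibniz {x} y x∈A = begin
    a * ad r (x * y)                  ≈⟨ *-congˡ (ad-leibniz r x y) ⟩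
    a * (ad r x * y + x * ad r y)     ≈⟨ distribˡ a _ _ ⟩
    a * (ad r x * y) + a * (x * ad r y) ≈⟨ +-cong (sym (*-assoc _ _ _)) (sym (*-assoc _ _ _)) ⟩
    δ x * y + (a * x) * ad r y        ≈⟨ +-congˡ (*-congʳ (comm a∈A x∈A)) ⟩
    δ x * y + (x * a) * ad r y        ≈⟨ +-congˡ (*-assoc _ _ _) ⟩
    δ x * y + x * δ y                 ∎

  ad-ar≈δ : ∀ {x} → x ∈ A → ad (a * r) x ≈ δ x
  ad-ar≈δ {x} x∈A = begin
    (a * r) * x - x * (a * r)   ≈⟨ +-cong (*-assoc a r x) (-‿cong (sym (*-assoc x a r))) ⟩
    a * (r * x) - (x * a) * r   ≈⟨ +-congˡ (-‿cong (*-congʳ (comm x∈A a∈A))) ⟩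
    a * (r * x) - (a * x) * r   ≈⟨ +-congˡ (-‿cong (*-assoc a x r)) ⟩
    a * (r * x) - a * (x * r)   ≈⟨ x[y-z]≈xy-xz a _ _ ⟨
    δ x                         ∎
    where open import Algebra.Properties.Ring R using (x[y-z]≈xy-xz)

  iterδ∈A : ∀ k → iter δ k a ∈ A
  iterδ∈A zero    = a∈A
  iterδ∈A (suc k) = δ∈A (iterδ∈A k)

  iter-ad-ar≈iterδ : ∀ k → iter (ad (a * r)) k a ≈ iter δ k a
  iter-ad-ar≈iterδ zero    = refl
  iter-ad-ar≈iterδ (suc k) = trans (ad-cong (a * r) (iter-ad-ar≈iterδ k)) (ad-ar≈δ (iterδ∈A k))

  ar-step : ∀ x y → (a * r) * (x * y) ≈ (a * x) * (r * y) + δ x * y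
  ar-step x y = begin
    (a * r) * (x * y)              ≈⟨ trans (*-assoc a r _) (*-congˡ (sym (*-assoc r x y))) ⟩
    a * ((r * x) * y)              ≈⟨ *-congˡ (*-congʳ (commute-past r x)) ⟩
    a * ((x * r + ad r x) * y)     ≈⟨ trans (*-congˡ (distribʳ y _ _)) (distribˡ a _ _) ⟩
    a * ((x * r) * y) + a * (ad r x * y) ≈⟨ +-cong (*-congˡ (*-assoc x r y)) (sym (*-assoc a _ y)) ⟩
    a * (x * (r * y)) + δ x * y    ≈⟨ +-congʳ (sym (*-assoc a x _)) ⟩
    (a * x) * (r * y) + δ x * y    ∎

  previous : (ℕ → Carrier) → ℕ → Carrier
  previous f zero    = 0#
  previous f (suc j) = f j

  -- coeff c n j is the coefficient of rʲ in (ar)ⁿ c, computed by ar-step: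
  -- coeff c (n+1) j = a · coeff c n (j-1) + δ (coeff c n j).
  coeff : Carrier → ℕ → ℕ → Carrier
  coeff c zero    zero    = c
  coeff c zero    (suc j) = 0#
  coeff c (suc n) j       = a * previous (coeff c n) j + δ (coeff c n j)

  expr-coeff : ∀ {c} → Expressible c → ∀ n j → Expressible (coeff c n j)
  expr-coeff ec zero    zero    = ec
  expr-coeff ec zero    (suc j) = expr-0
  expr-coeff ec (suc n) zero    = expr-+ (expr-* expr-a expr-0) (expr-δ (expr-coeff ec n zero))
  expr-coeff ec (suc n) (suc j) = expr-+ (expr-* expr-a (expr-coeff ec n j)) (expr-δ (expr-coeff ec n (suc j)))

  a·0+ : ∀ y → a * 0# + y ≈ y
  a·0+ y = trans (+-congʳ (zeroʳ a)) (+-identityˡ y)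

  coeff-vanish : ∀ c n j → n < j → coeff c n j ≈ 0#
  coeff-vanish c zero    (suc j) _         = refl
  coeff-vanish c (suc n) (suc j) (s≤s n<j) = begin
    a * coeff c n j + δ (coeff c n (suc j)) ≈⟨ +-cong (*-congˡ (coeff-vanish c n j n<j))
                                                      (δ-cong (coeff-vanish c n (suc j) (m≤n⇒m≤1+n n<j))) ⟩
    a * 0# + δ 0#                           ≈⟨ a·0+ _ ⟩
    δ 0#                                    ≈⟨ δ-0 ⟩
    0#                                      ∎

  expand : ∀ n c → pow (a * r) n * c ≈ ∑< (suc n) (λ j → coeff c n j * pow r j)
  expand zero    c = trans (*-identityˡ c) (sym (trans (+-identityʳ _) (*-identityʳ c)))
  expand (suc n) c = begin
    ((a * r) * pow (a * r) n) * c           ≈⟨ *-assoc _ _ c ⟩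
    (a * r) * (pow (a * r) n * c)           ≈⟨ *-congˡ (expand n c) ⟩
    (a * r) * ∑< (suc n) T                  ≈⟨ ∑-*ˡ (suc n) (a * r) T ⟩
    ∑< (suc n) (λ j → (a * r) * T j)
      ≈⟨ ∑-cong (suc n) (λ j _ → ar-step (coeff c n j) (pow r j)) ⟩
    ∑< (suc n) (λ j → S (suc j) + G j)      ≈⟨ ∑-+ (suc n) (λ j → S (suc j)) G ⟩
    ∑< (suc n) (λ j → S (suc j)) + ∑< (suc n) G
      ≈⟨ +-cong (sym (trans (+-congʳ S₀≈0) (+-identityˡ _))) (sym (∑-drop-last (suc n) G Gₙ₊₁≈0)) ⟩
    ∑< (suc (suc n)) S + ∑< (suc (suc n)) G ≈⟨ ∑-+ (suc (suc n)) S G ⟨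
    ∑< (suc (suc n)) (λ j → S j + G j)
      ≈⟨ ∑-cong (suc (suc n)) (λ j _ → distribʳ (pow r j) (a * previous (coeff c n) j) (δ (coeff c n j))) ⟨
    ∑< (suc (suc n)) (λ j → coeff c (suc n) j * pow r j) ∎
    where
    T S G : ℕ → Carrier
    T j = coeff c n j * pow r j
    S j = (a * previous (coeff c n) j) * pow r j
    G j = δ (coeff c n j) * pow r j
    S₀≈0 : S 0 ≈ 0#
    S₀≈0 = trans (*-congʳ (zeroʳ a)) (zeroˡ _)
    Gₙ₊₁≈0 : G (suc n) ≈ 0#
    Gₙ₊₁≈0 = trans (*-congʳ (trans (δ-cong (coeff-vanish c n (suc n) ≤-refl)) δ-0)) (zeroˡ _)

  coeff-bottom : ∀ c n → coeff c n 0 ≈ iter δ n c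
  coeff-bottom c zero    = refl
  coeff-bottom c (suc n) = trans (a·0+ _) (δ-cong (coeff-bottom c n))

  coeff-top : ∀ c n → coeff c n n ≈ pow a n * c
  coeff-top c zero    = sym (*-identityˡ c)
  coeff-top c (suc n) = begin
    a * coeff c n n + δ (coeff c n (suc n)) ≈⟨ +-cong (*-congˡ (coeff-top c n))
                                                      (trans (δ-cong (coeff-vanish c n (suc n) ≤-refl)) δ-0) ⟩
    a * (pow a n * c) + 0#                  ≈⟨ trans (+-identityʳ _) (sym (*-assoc a _ c)) ⟩
    pow a (suc n) * c                       ∎

  -- (ar)ⁿ⁺¹·1 = (ar)ⁿ·a·r, so its coefficients are those of (ar)ⁿ a shifted by one
  coeff-1-bottom : ∀ n → coeff 1# (suc n) 0 ≈ 0#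
  coeff-1-bottom zero    = trans (a·0+ _) δ-1
  coeff-1-bottom (suc n) = trans (a·0+ _) (trans (δ-cong (coeff-1-bottom n)) δ-0)

  coeff-shift : ∀ n j → coeff 1# (suc n) (suc j) ≈ coeff a n j
  coeff-shift zero    zero    = trans (+-cong (*-identityʳ a) δ-0) (+-identityʳ a)
  coeff-shift zero    (suc j) = trans (a·0+ _) δ-0
  coeff-shift (suc n) zero    = +-cong (*-congˡ (coeff-1-bottom n)) (δ-cong (coeff-shift n zero))
  coeff-shift (suc n) (suc j) = +-cong (*-congˡ (coeff-shift n j)) (δ-cong (coeff-shift n (suc j)))

  δ-× : ∀ n x → δ (n × x) ≈ n × δ x
  δ-× zero    x = δ-0
  δ-× (suc n) x = trans (δ-+ x (n × x)) (+-congˡ (δ-× n x))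

  ζ : ℕ → Carrier
  ζ zero    = 0#
  ζ (suc k) = iter δ k a

  ζ∈A : ∀ k → ζ k ∈ A
  ζ∈A zero    = zero∈
  ζ∈A (suc k) = iterδ∈A k

  expr-ζ : ∀ k → Expressible (ζ k)
  expr-ζ zero          = expr-0
  expr-ζ (suc zero)    = expr-a
  expr-ζ (suc (suc k)) = expr-δ (expr-ζ (suc k))

  -- ζ (k+1) = δ (ζ k), except for ζ 1 = a while δ (ζ 0) = 0
  ζ-step : ∀ k y → ζ (suc k) * y ≈ δ (ζ k) * y + atColumn0 k (a * y)
  ζ-step zero    y = sym (trans (+-congʳ (trans (*-congʳ δ-0) (zeroˡ y))) (+-identityˡ (a * y)))
  ζ-step (suc k) y = sym (+-identityʳ _)

  -- The key identity, for the coefficients of (ar)ⁿ·1: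
  --   (j+1)·coeff 1 n (j+1) = Σ_k C(n,k)·ζ(k)·coeff 1 (n-k) j,
  -- with the right-hand side written as a lattice sum.
  keySum : ℕ → ℕ → Carrier
  keySum n j = lattice n (λ k m → ζ k * coeff 1# m j)

  δ-keySum : ∀ n j → δ (keySum n j) ≈
             lattice n (λ k m → δ (ζ k) * coeff 1# m j) + lattice n (λ k m → ζ k * δ (coeff 1# m j))
  δ-keySum n j = begin
    δ (keySum n j)                                     ≈⟨ lattice-additive δ δ-cong δ-+ n _ ⟨
    lattice n (λ k m → δ (ζ k * coeff 1# m j))         ≈⟨ lattice-cong n (λ k m → δ-leibniz _ (ζ∈A k)) ⟩
    lattice n (λ k m → δ (ζ k) * coeff 1# m j + ζ k * δ (coeff 1# m j)) ≈⟨ lattice-+ n _ _ ⟩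
    lattice n (λ k m → δ (ζ k) * coeff 1# m j) + lattice n (λ k m → ζ k * δ (coeff 1# m j)) ∎

  -- paths whose last step increases k
  k-steps : ∀ n j → lattice n (λ k m → ζ (suc k) * coeff 1# m j) ≈
            lattice n (λ k m → δ (ζ k) * coeff 1# m j) + a * coeff 1# n j
  k-steps n j = begin
    lattice n (λ k m → ζ (suc k) * coeff 1# m j)
      ≈⟨ lattice-cong n (λ k m → ζ-step k (coeff 1# m j)) ⟩
    lattice n (λ k m → δ (ζ k) * coeff 1# m j + atColumn0 k (a * coeff 1# m j))
      ≈⟨ lattice-+ n _ _ ⟩
    lattice n (λ k m → δ (ζ k) * coeff 1# m j) + lattice n (λ k m → atColumn0 k (a * coeff 1# m j))
      ≈⟨ +-congˡ (lattice-column0 n (λ m → a * coeff 1# m j)) ⟩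
    lattice n (λ k m → δ (ζ k) * coeff 1# m j) + a * coeff 1# n j ∎

  -- paths whose last step increases m; this uses the key identity at (n, j-1)
  m-steps : ∀ n j → (∀ i → suc i × coeff 1# n (suc i) ≈ keySum n i) →
            lattice n (λ k m → ζ k * coeff 1# (suc m) j) ≈
            j × (a * coeff 1# n j) + lattice n (λ k m → ζ k * δ (coeff 1# m j))
  m-steps n j keyₙ = begin
    lattice n (λ k m → ζ k * (a * previous (coeff 1# m) j + δ (coeff 1# m j)))
      ≈⟨ lattice-cong n (λ k m → trans (distribˡ (ζ k) _ _) (+-congʳ (move-a k _))) ⟩
    lattice n (λ k m → a * (ζ k * previous (coeff 1# m) j) + ζ k * δ (coeff 1# m j))
      ≈⟨ lattice-+ n _ _ ⟩
    lattice n (λ k m → a * (ζ k * previous (coeff 1# m) j)) + _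
      ≈⟨ +-congʳ (lattice-additive (a *_) *-congˡ (distribˡ a) n _) ⟩
    a * lattice n (λ k m → ζ k * previous (coeff 1# m) j) + _
      ≈⟨ +-congʳ (previous-part j) ⟩
    j × (a * coeff 1# n j) + _ ∎
    where
    move-a : ∀ k y → ζ k * (a * y) ≈ a * (ζ k * y)
    move-a k y = trans (sym (*-assoc _ _ _)) (trans (*-congʳ (comm (ζ∈A k) a∈A)) (*-assoc _ _ _))
    previous-part : ∀ j → a * lattice n (λ k m → ζ k * previous (coeff 1# m) j) ≈ j × (a * coeff 1# n j)
    previous-part zero    = trans (*-congˡ (lattice-0 n (λ k m → zeroʳ (ζ k)))) (zeroʳ a)
    previous-part (suc i) = trans (*-congˡ (sym (keyₙ i))) (×-comm-* (suc i) a _)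

  coeff-keySum : ∀ n j → suc j × coeff 1# n (suc j) ≈ keySum n j
  coeff-keySum zero    j = trans (×-0# (suc j)) (sym (zeroˡ (coeff 1# 0 j)))
  coeff-keySum (suc n) j = begin
    suc j × (a * u n j + δ (u n (suc j)))          ≈⟨ ×-distrib-+ _ _ (suc j) ⟩
    suc j × (a * u n j) + suc j × δ (u n (suc j))  ≈⟨ +-congˡ (δ-× (suc j) _) ⟨
    (a * u n j + j × (a * u n j)) + δ (suc j × u n (suc j)) ≈⟨ +-congˡ (δ-cong (coeff-keySum n j)) ⟩
    (a * u n j + j × (a * u n j)) + δ (keySum n j) ≈⟨ +-congˡ (δ-keySum n j) ⟩
    (a * u n j + j × (a * u n j)) + (X + Y)        ≈⟨ shuffle _ _ _ _ ⟩
    (j × (a * u n j) + Y) + (X + a * u n j)        ≈⟨ +-cong (m-steps n j (coeff-keySum n)) (k-steps n j) ⟨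
    keySum (suc n) j                               ∎
    where
    u : ℕ → ℕ → Carrier
    u = coeff 1#
    X Y : Carrier
    X = lattice n (λ k m → δ (ζ k) * u m j)
    Y = lattice n (λ k m → ζ k * δ (u m j))

  module PrimeCase (q₁ : ℕ) (p-prime : Prime (suc (suc q₁))) where
    open Binomial using (binomial; prime∣binomial)
    open Divisibility (suc (suc q₁))
    open import Data.Nat.Divisibility using (divides)
    open import Data.Nat.Coprimality using (prime⇒coprime) renaming (sym to ⊥-sym)
    open import Data.Nat.Properties using (n∸n≡0)

    q : ℕ
    q = suc q₁

    -- every binomial coefficient C(p,k) with 0 < k < p is divisible by p; the
    -- terms k = 0 and k = p vanish since ζ 0 = 0 and coeff 1 0 (j+1) = 0
    keySum-divisible : ∀ j → Divisible (keySum (suc q) (suc j))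
    keySum-divisible j =
      div-resp (sym (trans (lattice-closed (suc q) (λ k m → ζ k * coeff 1# m (suc j))) (∑-peel q h)))
               (div-+ (div-+ (div-≈0 first≈0) (div-∑ q middle)) (div-≈0 last≈0))
      where
      h : ℕ → Carrier
      h k = binomial (suc q) k × (ζ k * coeff 1# (suc q ∸ k) (suc j))
      first≈0 : h 0 ≈ 0#
      first≈0 = trans (×-congʳ 1 (zeroˡ _)) (×-0# 1)
      last≈0 : h (suc q) ≈ 0#
      last≈0 = trans (×-congʳ C (trans (*-congˡ (reflexive (≡.cong (λ m → coeff 1# m (suc j)) (n∸n≡0 q))))
                                       (zeroʳ (ζ (suc q)))))
                     (×-0# C)
        where C = binomial (suc q) (suc q)
      middle : ∀ k → k < q → Divisible (h (suc k))
      middle k k<q with prime∣binomial p-prime k<q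
      ... | divides t C≡tp = div-resp (×-congˡ (≡.sym C≡tp))
                               (div-multiple t (expr-* (expr-ζ (suc k)) (expr-coeff expr-1 (q ∸ k) (suc j))))

    -- coeff 1 p (j+2) is divisible by p: cancel the unit j + 2 in the key identity
    coeff-divisible : ∀ j → suc j < q → Divisible (coeff 1# (suc q) (suc (suc j)))
    coeff-divisible j j+1<q =
      div-cancel (⊥-sym (prime⇒coprime p-prime (s≤s j+1<q))) (expr-coeff expr-1 (suc q) (suc (suc j)))
                 (div-resp (sym (coeff-keySum (suc q) (suc j))) (keySum-divisible j))

    -- (ar)^q a = Σ_{j ≤ q} coeff a q j rʲ; the extreme terms are ad_{ar}^q(a) and
    -- aᵖ r^q, and the others are divisible by p
    lhs-divisible : Divisible (lhsExpr (suc q) r a)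
    lhs-divisible = div-resp (sym lhs≈middle) (div-∑ q₁ middle-divisible)
      where
      T : ℕ → Carrier
      T j = coeff a q j * pow r j
      M X Y : Carrier
      M = ∑< q₁ (λ j → T (suc j))
      X = iter (ad (a * r)) q a
      Y = pow a (suc q) * pow r q
      middle-divisible : ∀ j → j < q₁ → Divisible (T (suc j))
      middle-divisible j j<q₁ = div-resp (*-congʳ (coeff-shift q (suc j)))
        (div-*ʳ (coeff-divisible j (s≤s j<q₁)) (expr-pow expr-r (suc j)))
      T₀≈X : T 0 ≈ X
      T₀≈X = trans (*-identityʳ _) (trans (coeff-bottom a q) (sym (iter-ad-ar≈iterδ q)))
      T_q≈Y : T q ≈ Y
      T_q≈Y = *-congʳ (trans (coeff-top a q) (pow-comm a q))
      lhs≈middle : lhsExpr (suc q) r a ≈ M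
      lhs≈middle = begin
        pow (a * r) q * a - Y - X        ≈⟨ +-congʳ (+-congʳ (trans (expand q a) (∑-peel q₁ T))) ⟩
        ((T 0 + M) + T q) - Y - X        ≈⟨ +-congʳ (+-congʳ (+-cong (+-congʳ T₀≈X) T_q≈Y)) ⟩
        ((X + M) + Y) - Y - X            ≈⟨ strip-ends X M Y ⟩
        M                                ∎

module Pointwise {c ℓ i} (R : Ring c ℓ) (I : Set i) where
  import Algebra.Construct.Pointwise as PW
  open Ring R using (Carrier; _≈_; _+_; _*_; -_; 1#; trans; reflexive)

  Rᴵ : Ring (i ⊔ c) (i ⊔ ℓ)
  Rᴵ = PW.ring I R

  private
    module O = RingOps R
    module Oᴵ = RingOps Rᴵ

  pow-at : ∀ f n x → Oᴵ.pow f n x ≡ O.pow (f x) n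
  pow-at f zero    x = ≡.refl
  pow-at f (suc n) x = ≡.cong (f x *_) (pow-at f n x)

  iter-ad-at : ∀ f g k x → Oᴵ.iter (Oᴵ.ad f) k g x ≡ O.iter (O.ad (f x)) k (g x)
  iter-ad-at f g zero    x = ≡.refl
  iter-ad-at f g (suc k) x = ≡.cong (O.ad (f x)) (iter-ad-at f g k x)

  natR-at : ∀ n x → Oᴵ.natR n x ≡ O.natR n
  natR-at zero    x = ≡.refl
  natR-at (suc n) x = ≡.cong (λ y → 1# + y) (natR-at n x)

  intR-at : ∀ k x → Oᴵ.intR k x ≡ O.intR k
  intR-at (+ n)    x = natR-at n x
  intR-at -[1+ n ] x = ≡.cong -_ (natR-at (suc n) x)

  evalMono-at : ∀ r a m x → Oᴵ.evalMono r a m x ≡ O.evalMono (r x) (a x) m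
  evalMono-at r a []            x = ≡.refl
  evalMono-at r a (vr   ∷ m)    x = ≡.cong (r x *_) (evalMono-at r a m x)
  evalMono-at r a (vx k ∷ m)    x = ≡.cong₂ _*_ (iter-ad-at r a k x) (evalMono-at r a m x)

  evalPoly-at : ∀ r a P x → Oᴵ.evalPoly r a P x ≡ O.evalPoly (r x) (a x) P
  evalPoly-at r a []            x = ≡.refl
  evalPoly-at r a ((k , m) ∷ P) x =
    ≡.cong₂ _+_ (≡.cong₂ _*_ (intR-at k x) (evalMono-at r a m x)) (evalPoly-at r a P x)

  lhsExpr-at : ∀ q r a x → Oᴵ.lhsExpr (suc q) r a x ≡ O.lhsExpr (suc q) (r x) (a x)
  lhsExpr-at q r a x = ≡.cong₂ (λ u v → u - v)
    (≡.cong₂ (λ u v → u - v) (≡.cong (_* a x) (pow-at (Ring._*_ Rᴵ a r) q x))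
                             (≡.cong₂ _*_ (pow-at a (suc q) x) (pow-at r q x)))
    (iter-ad-at (Ring._*_ Rᴵ a r) a q x)
    where open Ring R using (_-_)

  specialise : ∀ q r a P → Ring._≈_ Rᴵ (Oᴵ.lhsExpr (suc q) r a) (Oᴵ.evalPoly r a P) →
               ∀ x → O.lhsExpr (suc q) (r x) (a x) ≈ O.evalPoly (r x) (a x) P
  specialise q r a P lhs≈P x =
    trans (reflexive (≡.sym (lhsExpr-at q r a x))) (trans (lhs≈P x) (reflexive (evalPoly-at r a P x)))

  valuedIn : ∀ {ℓA} {A : Pred Carrier ℓA} → O.IsCommSubring A → Oᴵ.IsCommSubring (λ f → ∀ x → f x ∈ A)
  valuedIn A-subring = record
    { resp   = λ f≈g f∈ x → resp (f≈g x) (f∈ x)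
    ; zero∈  = λ _ → zero∈
    ; one∈   = λ _ → one∈
    ; +-cl   = λ f∈ g∈ x → +-cl (f∈ x) (g∈ x)
    ; neg-cl = λ f∈ x → neg-cl (f∈ x)
    ; *-cl   = λ f∈ g∈ x → *-cl (f∈ x) (g∈ x)
    ; comm   = λ f∈ g∈ x → comm (f∈ x) (g∈ x)
    }
    where open O.IsCommSubring A-subring

-- Products are imported only here: above, _×_ denotes ℕ-multiples in a ring.
open import Data.Product using (_×_; proj₁; proj₂)
open import Data.Nat using (nonTrivial⇒n>1)
open import Data.Nat.Primality using (prime⇒nonTrivial)

-- The generic point: index by I = {a ∈ A}, take r constant and a = proj₁.
module Generic {c ℓ ℓA} (R : Ring c ℓ) (r : Ring.Carrier R) (A : Pred (Ring.Carrier R) ℓA)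
    (A-subring : RingOps.IsCommSubring R A)
    (ad-closed : ∀ {x} → x ∈ A → RingOps.ad R r x ∈ A) where

  I : Set (c ⊔ ℓA)
  I = Σ (Ring.Carrier R) (_∈ A)

  open Pointwise R I

  rᴵ aᴵ : Ring.Carrier Rᴵ
  rᴵ = λ _ → r
  aᴵ = proj₁

  module GenericExpansion = Expansion Rᴵ rᴵ (λ f → ∀ x → f x ∈ A) (valuedIn A-subring)
                                      (λ f∈A x → ad-closed (f∈A x)) aᴵ proj₂
  open SignedSums Rᴵ rᴵ aᴵ using (SignedPoly; module Divisibility)

  universal : ∀ q₁ → Prime (suc (suc q₁)) →
    Σ NCPoly (λ P → AllCoeffsDivBy (+ suc (suc q₁)) P ×
      (∀ a → a ∈ A → Ring._≈_ R (RingOps.lhsExpr R (suc (suc q₁)) r a) (RingOps.evalPoly R r a P)))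
  universal q₁ p-prime =
    toNCPoly S , toNCPoly-coeffs S , λ a a∈A → specialise (suc q₁) rᴵ aᴵ (toNCPoly S) lhs≈P (a , a∈A)
    where
    open Divisibility (suc (suc q₁))
    open GenericExpansion.PrimeCase q₁ p-prime using (lhs-divisible)
    S : SignedPoly
    S = proj₁ lhs-divisible
    lhs≈P : Ring._≈_ Rᴵ (RingOps.lhsExpr Rᴵ (suc (suc q₁)) rᴵ aᴵ) (RingOps.evalPoly Rᴵ rᴵ aᴵ (toNCPoly S))
    lhs≈P = Ring.trans Rᴵ (proj₂ lhs-divisible) (Ring.sym Rᴵ (toNCPoly-eval S))

lemma8p1 : ∀ {c ℓ ℓA : Level} (R : Ring c ℓ) (r : Ring.Carrier R)
    (A : Pred (Ring.Carrier R) ℓA) →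
    RingOps.IsCommSubring R A →
    (∀ {a} → a ∈ A → RingOps.ad R r a ∈ A) →
    (p : ℕ) → Prime p →
    Σ NCPoly (λ P → AllCoeffsDivBy (+ p) P ×
      (∀ a → a ∈ A → Ring._≈_ R (RingOps.lhsExpr R p r a) (RingOps.evalPoly R r a P)))
lemma8p1 R r A A-subring ad-closed p p-prime with nonTrivial⇒n>1 p {{prime⇒nonTrivial p-prime}}
... | s≤s (s≤s {n = q₁} z≤n) = Generic.universal R r A A-subring ad-closed q₁ p-prime
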